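{- Let $k\ge2$ be even and $n\ge1$. Then $N''_{k,1,n}=(C_{k/2,n})^2=D'_{k,(k/2)^2n,\,n}$.
   Context: For $j\ge1$, a $j$-dimensional balanced ballot path of length $jn$ is a sequence of $jn$ standard unit vectors of $\mathbb{R}^j$, each $\vec e_i$ occurring exactly $n$ times, such that every intermediate point (partial sum) $\vec x=(x_1,\dots,x_j)$ satisfies $x_1\ge\cdots\ge x_j$; $C_{j,n}$ denotes the number of such paths. For a $k$-dimensional balanced ballot path, steps $\vec e_i$ with $i\le\lfloor k/2\rfloor$ are semisymmetric up-steps and steps $\vec e_j$ with $j\ge\lceil k/2\rceil+1$ are semisymmetric down-steps; a semisymmetric peak is an occurrence of a semisymmetric up-step immediately followed by a semisymmetric down-step. $N''_{k,\alpha,n}$ is the number of $k$-dimensional balanced ballot paths of length $kn$ with exactly $\alpha$ semisymmetric peaks. The semisymmetric height of $\vec x\in\mathbb{Z}^k_{\ge0}$ is $g_k(\vec x)=\sum_{i=1}^k(k+1-2i)x_i$, the semisymmetric height of a path is the maximum of $g_k$ over its intermediate points, and $D'_{k,u,n}$ is the number of $k$-dimensional balanced ballot paths of length $kn$ with semisymmetric height exactly $u$. -}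

module Defs where

open import Data.Bool using (Bool; true; false; _∧_; not)
open import Data.Nat as ℕ using (ℕ; zero; suc; _+_; _*_; _∸_; ⌊_/2⌋; ⌈_/2⌉)
open import Data.Fin as Fin using (Fin; toℕ)
open import Data.List using (List; []; _∷_; map; concatMap; allFin; inits; length; filterᵇ)
open import Data.Bool.ListAction using (all; any)
open import Data.Integer as ℤ using (ℤ; +_; _-_)
open import Relation.Nullary.Decidable using (⌊_⌋)

-- All words of length m over the alphabet Fin j (letter i stands for e_{i+1}).
words : (j m : ℕ) → List (List (Fin j))
words j zero    = [] ∷ []
words j (suc m) = concatMap (λ w → map (_∷ w) (allFin j)) (words j m)

occ : ∀ {j} → Fin j → List (Fin j) → ℕ
occ i []       = 0
occ i (a ∷ w) with ⌊ a Fin.≟ i ⌋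
... | true  = suc (occ i w)
... | false = occ i w

-- endpoint (x_1,...,x_j) of a path (a word of steps)
point : ∀ {j} → List (Fin j) → List ℕ
point {j} w = map (λ i → occ i w) (allFin j)

weaklyDecreasing : List ℕ → Bool
weaklyDecreasing []           = true
weaklyDecreasing (x ∷ [])     = true
weaklyDecreasing (x ∷ y ∷ xs) = ⌊ y ℕ.≤? x ⌋ ∧ weaklyDecreasing (y ∷ xs)

isBallot : (j n : ℕ) → List (Fin j) → Bool
isBallot j n w =
  all (λ i → ⌊ occ i w ℕ.≟ n ⌋) (allFin j) ∧ all (λ p → weaklyDecreasing (point p)) (inits w)

C : ℕ → ℕ → ℕ
C j n = length (filterᵇ (isBallot j n) (words j (j * n)))

-- semisymmetric up-step: e_i with i ≤ ⌊k/2⌋ (1-based), i.e. toℕ a < ⌊k/2⌋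
isUp : ∀ {k} → Fin k → Bool
isUp {k} a = ⌊ suc (toℕ a) ℕ.≤? ⌊ k /2⌋ ⌋

-- semisymmetric down-step: e_i with i ≥ ⌈k/2⌉+1 (1-based)
isDown : ∀ {k} → Fin k → Bool
isDown {k} a = ⌊ suc ⌈ k /2⌉ ℕ.≤? suc (toℕ a) ⌋

peakAt : ∀ {k} → Fin k → Fin k → ℕ
peakAt a b with isUp a ∧ isDown b
... | true  = 1
... | false = 0

peaks : ∀ {k} → List (Fin k) → ℕ
peaks []           = 0
peaks (a ∷ [])     = 0
peaks (a ∷ b ∷ w) = peakAt a b + peaks (b ∷ w)

N'' : ℕ → ℕ → ℕ → ℕ
N'' k α n = length (filterᵇ (λ w → isBallot k n w ∧ ⌊ peaks w ℕ.≟ α ⌋) (words k (k * n)))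

gsum : ℕ → ℕ → List ℕ → ℤ
gsum k i []       = + 0
gsum k i (x ∷ xs) = ((+ (k + 1) - + (2 * i)) ℤ.* + x) ℤ.+ gsum k (suc i) xs

g : (k : ℕ) → List ℕ → ℤ
g k x = gsum k 1 x

heightIs : (k : ℕ) → ℤ → List (Fin k) → Bool
heightIs k u w =
  any (λ p → ⌊ g k (point p) ℤ.≟ u ⌋) (inits w) ∧ all (λ p → ⌊ g k (point p) ℤ.≤? u ⌋) (inits w)

D' : ℕ → ℤ → ℕ → ℕ
D' k u n = length (filterᵇ (λ w → isBallot k n w ∧ heightIs k u w) (words k (k * n)))

{-# OPTIONS --safe #-}
-- Write k = h + h, so that the semisymmetric up-steps are the letters i ↑ˡ h and the
-- down-steps the letters h ↑ʳ i of Fin (h + h). Both counts turn out to count the paths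
-- u·v in which u uses only up-steps and v only down-steps; such a path is a ballot path
-- iff u and v are h-dimensional ballot paths, whence C_{h,n}² in both cases.
-- One peak: a ballot path neither starts with a down-step nor ends with an up-step, so a
-- down-step immediately followed by an up-step would have a peak on either side of it.
-- Height: on points with coordinates at most n,
--   g_{2h}(x) = h²n − Σ_{i≤h} (2h − 2i + 1)(n − x_i) − Σ_{t<h} (2t + 1) x_{h+1+t},
-- so g_{2h} ≤ h²n along a ballot path, with equality exactly at (n,…,n,0,…,0): the path
-- reaches height h²n iff some prefix consists of all up-steps and no down-step.
module Submission where

open import Defs
open import Data.Bool using (Bool; true; false; _∧_; _∨_; T)
open import Data.Bool.Properties using (∧-conicalˡ; ∧-conicalʳ; ∧-zeroʳ; ∨-zeroʳ)
open import Data.Bool.ListAction using (all; any; and; or)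
open import Data.Fin as Fin using (Fin; toℕ; _↑ˡ_; _↑ʳ_; splitAt)
open import Data.Fin.Properties
  using (toℕ-↑ˡ; toℕ-↑ʳ; ↑ˡ-injective; ↑ʳ-injective; toℕ<n; splitAt-↑ˡ; splitAt-↑ʳ) renaming (suc-injective to fsuc-injective)
open import Data.Integer as ℤ using (+_; -_)
import Data.Integer.Properties as ℤP
open import Data.Integer.Tactic.RingSolver using (solve-∀)
import Data.Nat.Tactic.RingSolver as ℕ-Solver
open import Data.List using (List; []; _∷_; [_]; map; concatMap; allFin; inits; length; filterᵇ; _++_; tabulate; replicate)
open import Data.List.Properties using (∷-injective; map-tabulate; tabulate-cong; map-++; length-map; map-∘; ++-identityʳ; ++-assoc; length-tabulate)
open import Data.List.Relation.Unary.All as All using (All; []; _∷_)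
open import Data.List.Relation.Unary.Any using (here; there)
open import Data.List.Membership.Propositional using (_∈_)
open import Data.List.Membership.Propositional.Properties using (∈-allFin)
open import Data.List.Relation.Unary.All.Properties using (tabulate⁻; tabulate⁺; ++⁻ʳ)
open import Data.Nat as ℕ using (ℕ; zero; suc; _+_; _*_; _∸_; _^_; _/_; _≤_; _<_; z≤n; s≤s; _≤?_; ⌊_/2⌋; ⌈_/2⌉)
open import Data.Nat.Divisibility using (_∣_; divides)
open import Data.Nat.DivMod using (m*n/n≡m)
open import Data.Nat.Properties
open import Algebra.Properties.CommutativeSemigroup +-commutativeSemigroup using () renaming (interchange to +-interchange)
open import Data.Product using (∃; ∃₂; _×_; _,_; proj₁; proj₂)
open import Data.Sum using (_⊎_; inj₁; inj₂)
open import Function using (_∘_; id)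
open import Relation.Binary.PropositionalEquality hiding ([_])
open import Relation.Nullary using (¬_; Dec; yes; no; contradiction)
open import Relation.Nullary.Decidable using (⌊_⌋; ⌊⌋-map′; isYes≗does; dec-true; dec-false; toWitness)

private variable
  A B : Set

𝟙 : Bool → ℕ
𝟙 true  = 1
𝟙 false = 0

𝟙-∧ : ∀ a b → 𝟙 (a ∧ b) ≡ 𝟙 a * 𝟙 b
𝟙-∧ true  b = sym (+-identityʳ (𝟙 b))
𝟙-∧ false b = refl

𝟙-false : ∀ {a} → ¬ (a ≡ true) → 𝟙 a ≡ 0
𝟙-false {true}  ¬a = contradiction refl ¬a
𝟙-false {false} ¬a = refl

∧-true : ∀ {a b} → a ∧ b ≡ true → a ≡ true × b ≡ true
∧-true {a} {b} e = ∧-conicalˡ a b e , ∧-conicalʳ a b e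

∨-true : ∀ {a b} → a ∨ b ≡ true → a ≡ true ⊎ b ≡ true
∨-true {true}  e = inj₁ refl
∨-true {false} e = inj₂ e

∧-implied : ∀ {a b} → (a ≡ true → b ≡ true) → a ∧ b ≡ a
∧-implied {true}  a⇒b = a⇒b refl
∧-implied {false} a⇒b = refl

bool-ext : ∀ {a b} → (a ≡ true → b ≡ true) → (b ≡ true → a ≡ true) → a ≡ b
bool-ext {true}          a⇒b b⇒a = sym (a⇒b refl)
bool-ext {false} {true}  a⇒b b⇒a = b⇒a refl
bool-ext {false} {false} a⇒b b⇒a = refl

⌊⌋-true : (a? : Dec A) → A → ⌊ a? ⌋ ≡ true
⌊⌋-true a? a = trans (isYes≗does a?) (dec-true a? a)

⌊⌋-false : (a? : Dec A) → ¬ A → ⌊ a? ⌋ ≡ false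
⌊⌋-false a? ¬a = trans (isYes≗does a?) (dec-false a? ¬a)

⌊⌋-sound : (a? : Dec A) → ⌊ a? ⌋ ≡ true → A
⌊⌋-sound a? e = toWitness {a? = a?} (subst T (sym e) _)

prefix-++ : ∀ (a b p r : List A) → a ++ b ≡ p ++ r →
  (∃ λ r′ → a ≡ p ++ r′) ⊎ (∃ λ q → p ≡ a ++ q × b ≡ q ++ r)
prefix-++ a       b []      r eq   = inj₁ (a , refl)
prefix-++ []      b (x ∷ p) r eq   = inj₂ (x ∷ p , refl , eq)
prefix-++ (x ∷ a) b (y ∷ p) r eq with ∷-injective eq
... | refl , eq′ with prefix-++ a b p r eq′
...   | inj₁ (r′ , refl)     = inj₁ (r′ , refl)
...   | inj₂ (q , refl , eq″) = inj₂ (q , refl , eq″)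

++-injective : ∀ (a b p r : List A) → a ++ b ≡ p ++ r → length a ≡ length p → a ≡ p × b ≡ r
++-injective []      b []      r eq ∣a∣≡∣p∣ = refl , eq
++-injective (x ∷ a) b (y ∷ p) r eq ∣a∣≡∣p∣ with ∷-injective eq
... | refl , eq′ with ++-injective a b p r eq′ (suc-injective ∣a∣≡∣p∣)
...   | refl , refl = refl , refl

prefix-map : ∀ (f : A → B) xs p r → map f xs ≡ p ++ r → ∃₂ λ p′ r′ → p ≡ map f p′ × xs ≡ p′ ++ r′
prefix-map f xs       []      r eq = [] , xs , refl , refl
prefix-map f (x ∷ xs) (y ∷ p) r eq with ∷-injective eq
... | refl , eq′ with prefix-map f xs p r eq′
...   | p′ , r′ , refl , refl = x ∷ p′ , r′ , refl , refl

tabulate-const : ∀ {j} (c : A) → tabulate {n = j} (λ _ → c) ≡ replicate j c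
tabulate-const {j = zero}  c = refl
tabulate-const {j = suc j} c = cong (c ∷_) (tabulate-const c)

-- Sums over lists and over all words of a given length

∑ : List A → (A → ℕ) → ℕ
∑ []       f = 0
∑ (x ∷ xs) f = f x + ∑ xs f

∑-++ : ∀ (xs ys : List A) f → ∑ (xs ++ ys) f ≡ ∑ xs f + ∑ ys f
∑-++ []       ys f = refl
∑-++ (x ∷ xs) ys f = trans (cong (_+_ (f x)) (∑-++ xs ys f)) (sym (+-assoc (f x) _ _))

∑-map : ∀ (g : A → B) xs f → ∑ (map g xs) f ≡ ∑ xs (f ∘ g)
∑-map g []       f = refl
∑-map g (x ∷ xs) f = cong (_+_ (f (g x))) (∑-map g xs f)

∑-concatMap : ∀ (g : A → List B) xs f → ∑ (concatMap g xs) f ≡ ∑ xs (λ x → ∑ (g x) f)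
∑-concatMap g []       f = refl
∑-concatMap g (x ∷ xs) f = trans (∑-++ (g x) _ f) (cong (_+_ (∑ (g x) f)) (∑-concatMap g xs f))

∑-cong : ∀ (xs : List A) {f g} → (∀ x → f x ≡ g x) → ∑ xs f ≡ ∑ xs g
∑-cong []       f≗g = refl
∑-cong (x ∷ xs) f≗g = cong₂ _+_ (f≗g x) (∑-cong xs f≗g)

∑-zero : ∀ (xs : List A) → ∑ xs (λ _ → 0) ≡ 0
∑-zero []       = refl
∑-zero (x ∷ xs) = ∑-zero xs

∑-+ : ∀ (xs : List A) f g → ∑ xs (λ x → f x + g x) ≡ ∑ xs f + ∑ xs g
∑-+ []       f g = refl
∑-+ (x ∷ xs) f g = trans (cong (_+_ (f x + g x)) (∑-+ xs f g)) (+-interchange (f x) (g x) (∑ xs f) (∑ xs g))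

∑-*ʳ : ∀ (xs : List A) f c → ∑ xs (λ x → f x * c) ≡ ∑ xs f * c
∑-*ʳ []       f c = refl
∑-*ʳ (x ∷ xs) f c = trans (cong (_+_ (f x * c)) (∑-*ʳ xs f c)) (sym (*-distribʳ-+ c (f x) (∑ xs f)))

∑-*ˡ : ∀ (xs : List A) c f → ∑ xs (λ x → c * f x) ≡ c * ∑ xs f
∑-*ˡ []       c f = sym (*-zeroʳ c)
∑-*ˡ (x ∷ xs) c f = trans (cong (_+_ (c * f x)) (∑-*ˡ xs c f)) (sym (*-distribˡ-+ c (f x) (∑ xs f)))

∑-const : ∀ (xs : List A) c → ∑ xs (λ _ → c) ≡ length xs * c
∑-const []       c = refl
∑-const (x ∷ xs) c = cong (_+_ c) (∑-const xs c)

length-filterᵇ : ∀ (P : A → Bool) xs → length (filterᵇ P xs) ≡ ∑ xs (𝟙 ∘ P)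
length-filterᵇ P []       = refl
length-filterᵇ P (x ∷ xs) with P x
... | true  = cong suc (length-filterᵇ P xs)
... | false = length-filterᵇ P xs

data Side (m n : ℕ) : Fin (m + n) → Set where
  left  : (i : Fin m) → Side m n (i ↑ˡ n)
  right : (j : Fin n) → Side m n (m ↑ʳ j)

side : ∀ m {n} (a : Fin (m + n)) → Side m n a
side zero    a        = right a
side (suc m) Fin.zero = left Fin.zero
side (suc m) (Fin.suc a) with side m a
... | left  i = left (Fin.suc i)
... | right j = right j

↑ˡ≢↑ʳ : ∀ {m n} (i : Fin m) (j : Fin n) → i ↑ˡ n ≢ m ↑ʳ j
↑ˡ≢↑ʳ {m} {n} i j eq with trans (sym (splitAt-↑ˡ m i n)) (trans (cong (splitAt m) eq) (splitAt-↑ʳ m n j))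
... | ()

tabulate-+ : ∀ m n (f : Fin (m + n) → A) → tabulate f ≡ tabulate (f ∘ (_↑ˡ n)) ++ tabulate (f ∘ (m ↑ʳ_))
tabulate-+ zero    n f = refl
tabulate-+ (suc m) n f = cong (f Fin.zero ∷_) (tabulate-+ m n (f ∘ Fin.suc))

∑-tabulate : ∀ {j} (g : Fin j → A) G → ∑ (tabulate g) G ≡ ∑ (allFin j) (G ∘ g)
∑-tabulate g G = trans (cong (λ as → ∑ as G) (sym (map-tabulate id g))) (∑-map g (allFin _) G)

∑-allFin-+ : ∀ m n G → ∑ (allFin (m + n)) G ≡ ∑ (allFin m) (G ∘ (_↑ˡ n)) + ∑ (allFin n) (G ∘ (m ↑ʳ_))
∑-allFin-+ m n G = trans (cong (λ as → ∑ as G) (tabulate-+ m n id))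
  (trans (∑-++ (tabulate (_↑ˡ n)) _ G) (cong₂ _+_ (∑-tabulate (_↑ˡ n) G) (∑-tabulate (m ↑ʳ_) G)))

∑-𝟙-≟ : ∀ {j} (a : Fin j) → ∑ (allFin j) (λ i → 𝟙 ⌊ a Fin.≟ i ⌋) ≡ 1
∑-𝟙-≟ {suc j} Fin.zero    = cong suc (trans (∑-tabulate {j = j} Fin.suc (λ i → 𝟙 ⌊ Fin.zero Fin.≟ i ⌋)) (∑-zero (allFin j)))
∑-𝟙-≟ {suc j} (Fin.suc a) = trans (∑-tabulate {j = j} Fin.suc (λ i → 𝟙 ⌊ Fin.suc a Fin.≟ i ⌋))
  (trans (∑-cong (allFin j) (λ i → cong 𝟙 (⌊⌋-map′ (cong Fin.suc) fsuc-injective (a Fin.≟ i)))) (∑-𝟙-≟ a))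

∑words : (j m : ℕ) → (List (Fin j) → ℕ) → ℕ
∑words j m F = ∑ (words j m) F

∑words-suc : ∀ j m F → ∑words j (suc m) F ≡ ∑words j m (λ w → ∑ (allFin j) (λ a → F (a ∷ w)))
∑words-suc j m F = trans (∑-concatMap _ (words j m) F) (∑-cong (words j m) (λ w → ∑-map (_∷ w) (allFin j) F))

∑words-cong : ∀ j m {F G} → (∀ w → length w ≡ m → F w ≡ G w) → ∑words j m F ≡ ∑words j m G
∑words-cong j zero    F≗G = cong (_+ 0) (F≗G [] refl)
∑words-cong j (suc m) {F} {G} F≗G = begin
  ∑words j (suc m) F
    ≡⟨ ∑words-suc j m F ⟩
  ∑words j m (λ w → ∑ (allFin j) (λ a → F (a ∷ w)))
    ≡⟨ ∑words-cong j m (λ w ∣w∣ → ∑-cong (allFin j) (λ a → F≗G (a ∷ w) (cong suc ∣w∣))) ⟩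
  ∑words j m (λ w → ∑ (allFin j) (λ a → G (a ∷ w)))
    ≡⟨ ∑words-suc j m G ⟨
  ∑words j (suc m) G ∎
  where open ≡-Reasoning

∑words-+ : ∀ j a b F → ∑words j (a + b) F ≡ ∑words j b (λ v → ∑words j a (λ u → F (u ++ v)))
∑words-+ j zero    b F = ∑-cong (words j b) (λ v → sym (+-identityʳ (F v)))
∑words-+ j (suc a) b F = begin
  ∑words j (suc (a + b)) F
    ≡⟨ ∑words-suc j (a + b) F ⟩
  ∑words j (a + b) (λ w → ∑ (allFin j) (λ c → F (c ∷ w)))
    ≡⟨ ∑words-+ j a b _ ⟩
  ∑words j b (λ v → ∑words j a (λ u → ∑ (allFin j) (λ c → F (c ∷ u ++ v))))
    ≡⟨ ∑-cong (words j b) (λ v → ∑words-suc j a (λ u → F (u ++ v))) ⟨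
  ∑words j b (λ v → ∑words j (suc a) (λ u → F (u ++ v))) ∎
  where open ≡-Reasoning

∑words-restrict : ∀ {h k} (ι κ : Fin h → Fin k) (c : Fin k → Bool) →
  (∀ G → ∑ (allFin k) G ≡ ∑ (allFin h) (G ∘ ι) + ∑ (allFin h) (G ∘ κ)) →
  (∀ i → c (κ i) ≡ false) →
  ∀ m F → (∀ w → length w ≡ m → all c w ≡ false → F w ≡ 0) →
  ∑words k m F ≡ ∑words h m (F ∘ map ι)
∑words-restrict ι κ c split c∘κ zero    F F-vanishes = refl
∑words-restrict {h} {k} ι κ c split c∘κ (suc m) F F-vanishes = begin
  ∑words k (suc m) F                                        ≡⟨ ∑words-suc k m F ⟩
  ∑words k m (λ w → ∑ (allFin k) (λ a → F (a ∷ w)))         ≡⟨ ∑words-restrict ι κ c split c∘κ m _ extensions-vanish ⟩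
  ∑words h m (λ w → ∑ (allFin k) (λ a → F (a ∷ map ι w)))   ≡⟨ ∑words-cong h m ι-steps-only ⟩
  ∑words h m (λ w → ∑ (allFin h) (λ i → F (ι i ∷ map ι w))) ≡⟨ ∑words-suc h m (F ∘ map ι) ⟨
  ∑words h (suc m) (F ∘ map ι)                              ∎
  where
  open ≡-Reasoning
  extensions-vanish : ∀ w → length w ≡ m → all c w ≡ false → ∑ (allFin k) (λ a → F (a ∷ w)) ≡ 0
  extensions-vanish w ∣w∣ cw = trans
    (∑-cong (allFin k) (λ a → F-vanishes (a ∷ w) (cong suc ∣w∣) (trans (cong (c a ∧_) cw) (∧-zeroʳ (c a)))))
    (∑-zero (allFin k))
  κ-steps-vanish : ∀ w → length w ≡ m → ∑ (allFin h) (λ i → F (κ i ∷ map ι w)) ≡ 0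
  κ-steps-vanish w ∣w∣ = trans
    (∑-cong (allFin h) (λ i → F-vanishes (κ i ∷ map ι w) (cong suc (trans (length-map ι w) ∣w∣)) (cong (_∧ all c (map ι w)) (c∘κ i))))
    (∑-zero (allFin h))
  ι-steps-only : ∀ w → length w ≡ m → ∑ (allFin k) (λ a → F (a ∷ map ι w)) ≡ ∑ (allFin h) (λ i → F (ι i ∷ map ι w))
  ι-steps-only w ∣w∣ = begin
    ∑ (allFin k) (λ a → F (a ∷ map ι w))                                            ≡⟨ split _ ⟩
    ∑ (allFin h) (λ i → F (ι i ∷ map ι w)) + ∑ (allFin h) (λ i → F (κ i ∷ map ι w)) ≡⟨ cong (_+_ _) (κ-steps-vanish w ∣w∣) ⟩
    ∑ (allFin h) (λ i → F (ι i ∷ map ι w)) + 0                                      ≡⟨ +-identityʳ _ ⟩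
    ∑ (allFin h) (λ i → F (ι i ∷ map ι w))                                          ∎

module _ {j : ℕ} where

  occ-∷-≡ : ∀ (a : Fin j) w → occ a (a ∷ w) ≡ suc (occ a w)
  occ-∷-≡ a w rewrite ⌊⌋-true (a Fin.≟ a) refl = refl

  occ-∷-≢ : ∀ {a i : Fin j} w → a ≢ i → occ i (a ∷ w) ≡ occ i w
  occ-∷-≢ {a} {i} w a≢i rewrite ⌊⌋-false (a Fin.≟ i) a≢i = refl

  occ-++ : ∀ (i : Fin j) xs ys → occ i (xs ++ ys) ≡ occ i xs + occ i ys
  occ-++ i []       ys = refl
  occ-++ i (a ∷ xs) ys with ⌊ a Fin.≟ i ⌋
  ... | true  = cong suc (occ-++ i xs ys)
  ... | false = occ-++ i xs ys

  occ-∷ : ∀ (i a : Fin j) w → occ i (a ∷ w) ≡ 𝟙 ⌊ a Fin.≟ i ⌋ + occ i w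
  occ-∷ i a w with ⌊ a Fin.≟ i ⌋
  ... | true  = refl
  ... | false = refl

  ∑-occ : ∀ (w : List (Fin j)) → ∑ (allFin j) (λ i → occ i w) ≡ length w
  ∑-occ []      = ∑-zero (allFin j)
  ∑-occ (a ∷ w) = begin
    ∑ (allFin j) (λ i → occ i (a ∷ w))                                      ≡⟨ ∑-cong (allFin j) (λ i → occ-∷ i a w) ⟩
    ∑ (allFin j) (λ i → 𝟙 ⌊ a Fin.≟ i ⌋ + occ i w)                          ≡⟨ ∑-+ (allFin j) _ _ ⟩
    ∑ (allFin j) (λ i → 𝟙 ⌊ a Fin.≟ i ⌋) + ∑ (allFin j) (λ i → occ i w)     ≡⟨ cong₂ _+_ (∑-𝟙-≟ a) (∑-occ w) ⟩
    suc (length w)                                                          ∎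
    where open ≡-Reasoning


  length-balanced : ∀ n (w : List (Fin j)) → (∀ i → occ i w ≡ n) → length w ≡ j * n
  length-balanced n w balanced = begin
    length w                         ≡⟨ ∑-occ w ⟨
    ∑ (allFin j) (λ i → occ i w)     ≡⟨ ∑-cong (allFin j) balanced ⟩
    ∑ (allFin j) (λ _ → n)           ≡⟨ ∑-const (allFin j) n ⟩
    length (allFin j) * n            ≡⟨ cong (_* n) (length-tabulate {n = j} id) ⟩
    j * n                            ∎
    where open ≡-Reasoning

occ-map-injective : ∀ {j k} (f : Fin j → Fin k) → (∀ {a b} → f a ≡ f b → a ≡ b) → ∀ i xs → occ (f i) (map f xs) ≡ occ i xs
occ-map-injective f inj i []       = refl
occ-map-injective f inj i (a ∷ xs) with a Fin.≟ i
... | yes refl = trans (occ-∷-≡ (f a) (map f xs)) (cong suc (occ-map-injective f inj a xs))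
... | no  a≢i  = trans (occ-∷-≢ (map f xs) (a≢i ∘ inj)) (occ-map-injective f inj i xs)

occ-map-∉ : ∀ {j k} (f : Fin j → Fin k) x → (∀ a → f a ≢ x) → ∀ xs → occ x (map f xs) ≡ 0
occ-map-∉ f x x∉f []       = refl
occ-map-∉ f x x∉f (a ∷ xs) = trans (occ-∷-≢ (map f xs) (x∉f a)) (occ-map-∉ f x x∉f xs)

all-true⁻ : ∀ (f : A → Bool) {xs x} → all f xs ≡ true → x ∈ xs → f x ≡ true
all-true⁻ f {y ∷ xs} e (here refl) = proj₁ (∧-true e)
all-true⁻ f {y ∷ xs} e (there x∈) = all-true⁻ f (proj₂ (∧-true {f y} e)) x∈

all-true⁺ : ∀ (f : A → Bool) xs → (∀ x → f x ≡ true) → all f xs ≡ true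
all-true⁺ f []       f-true = refl
all-true⁺ f (x ∷ xs) f-true = cong₂ _∧_ (f-true x) (all-true⁺ f xs f-true)

Prefixwise : (List A → Set) → List A → Set
Prefixwise P w = ∀ p r → w ≡ p ++ r → P p

all-inits-∷ : ∀ (f : List A → Bool) x w → all f (inits (x ∷ w)) ≡ f [] ∧ all (f ∘ (x ∷_)) (inits w)
all-inits-∷ f x w = cong (λ bs → f [] ∧ and bs) (sym (map-∘ (inits w)))

any-inits-∷ : ∀ (f : List A → Bool) x w → any f (inits (x ∷ w)) ≡ f [] ∨ any (f ∘ (x ∷_)) (inits w)
any-inits-∷ f x w = cong (λ bs → f [] ∨ or bs) (sym (map-∘ (inits w)))

all-inits⁻ : ∀ (f : List A → Bool) w → all f (inits w) ≡ true → Prefixwise (λ p → f p ≡ true) w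
all-inits⁻ f w       e []      r refl = proj₁ (∧-true e)
all-inits⁻ f (x ∷ w) e (x ∷ p) r refl =
  all-inits⁻ (f ∘ (x ∷_)) w (proj₂ (∧-true {f []} (trans (sym (all-inits-∷ f x w)) e))) p r refl

all-inits⁺ : ∀ (f : List A → Bool) w → Prefixwise (λ p → f p ≡ true) w → all f (inits w) ≡ true
all-inits⁺ f []      f-prefixes = cong (_∧ true) (f-prefixes [] [] refl)
all-inits⁺ f (x ∷ w) f-prefixes = trans (all-inits-∷ f x w)
  (cong₂ _∧_ (f-prefixes [] (x ∷ w) refl) (all-inits⁺ (f ∘ (x ∷_)) w (λ p r eq → f-prefixes (x ∷ p) r (cong (x ∷_) eq))))

any-inits⁻ : ∀ (f : List A → Bool) w → any f (inits w) ≡ true → ∃₂ λ p r → w ≡ p ++ r × f p ≡ true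
any-inits⁻ f [] e with ∨-true {f []} e
... | inj₁ f[] = [] , [] , refl , f[]
any-inits⁻ f (x ∷ w) e with ∨-true {f []} (trans (sym (any-inits-∷ f x w)) e)
... | inj₁ f[] = [] , x ∷ w , refl , f[]
... | inj₂ e′ with any-inits⁻ (f ∘ (x ∷_)) w e′
...   | p , r , refl , fp = x ∷ p , r , refl , fp

any-inits⁺ : ∀ (f : List A → Bool) p r → f p ≡ true → any f (inits (p ++ r)) ≡ true
any-inits⁺ f []      r fp = cong (_∨ or (map f (Data.List.Inits.tail r))) fp
any-inits⁺ f (x ∷ p) r fp = trans (any-inits-∷ f x (p ++ r))
  (trans (cong (f [] ∨_) (any-inits⁺ (f ∘ (x ∷_)) p r fp)) (∨-zeroʳ (f [])))

-- Ballot paths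

weaklyDecreasing-∷⁻ : ∀ x ys → weaklyDecreasing (x ∷ ys) ≡ true → All (_≤ x) ys × weaklyDecreasing ys ≡ true
weaklyDecreasing-∷⁻ x []       e = [] , refl
weaklyDecreasing-∷⁻ x (y ∷ ys) e with ∧-true {⌊ y ≤? x ⌋} e
... | y≤?x , wd-ys = y≤x ∷ All.map (λ z≤y → ≤-trans z≤y y≤x) (proj₁ (weaklyDecreasing-∷⁻ y ys wd-ys)) , wd-ys
  where y≤x = ⌊⌋-sound (y ≤? x) y≤?x

weaklyDecreasing-++⁻ : ∀ xs ys → weaklyDecreasing (xs ++ ys) ≡ true → All (λ x → All (_≤ x) ys) xs
weaklyDecreasing-++⁻ []       ys e = []
weaklyDecreasing-++⁻ (x ∷ xs) ys e with weaklyDecreasing-∷⁻ x (xs ++ ys) e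
... | below-x , wd-rest = ++⁻ʳ xs below-x ∷ weaklyDecreasing-++⁻ xs ys wd-rest

weaklyDecreasing-replicate-++ : ∀ m n ys → All (_≤ n) ys → weaklyDecreasing (replicate m n ++ ys) ≡ weaklyDecreasing ys
weaklyDecreasing-replicate-++ zero          n ys       ys≤n         = refl
weaklyDecreasing-replicate-++ (suc zero)    n []       ys≤n         = refl
weaklyDecreasing-replicate-++ (suc zero)    n (y ∷ ys) (y≤n ∷ ys≤n) = cong (_∧ weaklyDecreasing (y ∷ ys)) (⌊⌋-true (y ≤? n) y≤n)
weaklyDecreasing-replicate-++ (suc (suc m)) n ys       ys≤n         =
  trans (cong (_∧ weaklyDecreasing (replicate (suc m) n ++ ys)) (⌊⌋-true (n ≤? n) ≤-refl))
        (weaklyDecreasing-replicate-++ (suc m) n ys ys≤n)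

weaklyDecreasing-++-zeros : ∀ xs m → weaklyDecreasing (xs ++ replicate m 0) ≡ weaklyDecreasing xs
weaklyDecreasing-++-zeros []           m       = trans (cong weaklyDecreasing (sym (++-identityʳ (replicate m 0))))
                                                       (weaklyDecreasing-replicate-++ m 0 [] [])
weaklyDecreasing-++-zeros (x ∷ [])     zero    = refl
weaklyDecreasing-++-zeros (x ∷ [])     (suc m) = cong₂ _∧_ (⌊⌋-true (0 ≤? x) z≤n) (weaklyDecreasing-++-zeros [] (suc m))
weaklyDecreasing-++-zeros (x ∷ y ∷ xs) m       = cong (⌊ y ≤? x ⌋ ∧_) (weaklyDecreasing-++-zeros (y ∷ xs) m)

point-tabulate : ∀ {j} (w : List (Fin j)) → point w ≡ tabulate (λ i → occ i w)
point-tabulate w = map-tabulate id (λ i → occ i w)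

point-const : ∀ {j} c (w : List (Fin j)) → (∀ i → occ i w ≡ c) → point w ≡ replicate j c
point-const c w occ≡c = trans (point-tabulate w) (trans (tabulate-cong occ≡c) (tabulate-const c))

occ-prefix-≤ : ∀ {j} n (p r : List (Fin j)) → (∀ a → occ a (p ++ r) ≡ n) → ∀ a → occ a p ≤ n
occ-prefix-≤ n p r balanced a = subst (occ a p ≤_) (trans (sym (occ-++ a p r)) (balanced a)) (m≤m+n (occ a p) (occ a r))

point-prefix-≤ : ∀ {j} n (q r : List (Fin j)) → (∀ i → occ i (q ++ r) ≡ n) → All (_≤ n) (point q)
point-prefix-≤ n q r balanced = subst (All (_≤ n)) (sym (point-tabulate q)) (tabulate⁺ (occ-prefix-≤ n q r balanced))

record Ballot (j n : ℕ) (w : List (Fin j)) : Set where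
  field
    balanced : ∀ i → occ i w ≡ n
    prefixes : Prefixwise (λ p → weaklyDecreasing (point p) ≡ true) w
open Ballot

isBallot⁻ : ∀ j n w → isBallot j n w ≡ true → Ballot j n w
isBallot⁻ j n w e with ∧-true {all (λ i → ⌊ occ i w ℕ.≟ n ⌋) (allFin j)} e
... | counts , ballot = record
  { balanced = λ i → ⌊⌋-sound (occ i w ℕ.≟ n) (all-true⁻ _ counts (∈-allFin i))
  ; prefixes = all-inits⁻ (weaklyDecreasing ∘ point) w ballot
  }

isBallot⁺ : ∀ j n w → Ballot j n w → isBallot j n w ≡ true
isBallot⁺ j n w b = cong₂ _∧_
  (all-true⁺ _ (allFin j) (λ i → ⌊⌋-true (occ i w ℕ.≟ n) (balanced b i)))
  (all-inits⁺ (weaklyDecreasing ∘ point) w (prefixes b))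

-- Semisymmetric peaks

peakAt≡𝟙 : ∀ {k} (a b : Fin k) → peakAt a b ≡ 𝟙 (isUp a ∧ isDown b)
peakAt≡𝟙 a b with isUp a ∧ isDown b
... | true  = refl
... | false = refl

peaks-++ : ∀ {k} (xs ys : List (Fin k)) → peaks xs + peaks ys ≤ peaks (xs ++ ys)
peaks-++ []          ys       = ≤-refl
peaks-++ (a ∷ [])    []       = ≤-refl
peaks-++ (a ∷ [])    (b ∷ ys) = m≤n+m (peaks (b ∷ ys)) (peakAt a b)
peaks-++ (a ∷ b ∷ xs) ys      = ≤-trans (≤-reflexive (+-assoc (peakAt a b) _ _)) (+-monoʳ-≤ (peakAt a b) (peaks-++ (b ∷ xs) ys))

-- Semisymmetric height

pos-+-* : ∀ a b c → + (a * b + c) ≡ + a ℤ.* + b ℤ.+ + c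
pos-+-* a b c = trans (ℤP.pos-+ (a * b) c) (cong (ℤ._+ + c) (ℤP.pos-* a b))

pos-minus-pos : ∀ a b c → a ≡ b + c → + a ℤ.- + b ≡ + c
pos-minus-pos a b c refl = trans (cong (ℤ._- + b) (ℤP.pos-+ b c)) (cancel (+ b) (+ c))
  where
  cancel : ∀ B C → B ℤ.+ C ℤ.- B ≡ C
  cancel = solve-∀

pos-minus-pos′ : ∀ a b c → b ≡ a + c → + a ℤ.- + b ≡ - + c
pos-minus-pos′ a b c refl = trans (cong (λ z → + a ℤ.- z) (ℤP.pos-+ a c)) (cancel (+ a) (+ c))
  where
  cancel : ∀ A C → A ℤ.- (A ℤ.+ C) ≡ - C
  cancel = solve-∀

gsum-++ : ∀ k i xs ys → gsum k i (xs ++ ys) ≡ gsum k i xs ℤ.+ gsum k (i + length xs) ys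
gsum-++ k i []       ys = sym (trans (ℤP.+-identityˡ _) (cong (λ j → gsum k j ys) (+-identityʳ i)))
gsum-++ k i (x ∷ xs) ys = trans
  (cong (λ z → (+ (k + 1) ℤ.- + (2 * i)) ℤ.* + x ℤ.+ z)
        (trans (gsum-++ k (suc i) xs ys) (cong (λ j → gsum k (suc i) xs ℤ.+ gsum k j ys) (sym (+-suc i (length xs))))))
  (sym (ℤP.+-assoc ((+ (k + 1) ℤ.- + (2 * i)) ℤ.* + x) (gsum k (suc i) xs) _))

-- The two sums of the header; in upperDeficit the weight 2(h − i) + 1 of x_i is
-- 2 · (number of entries after x_i) + 1.
upperDeficit : ℕ → List ℕ → ℕ
upperDeficit n []       = 0
upperDeficit n (x ∷ xs) = suc (2 * length xs) * (n ∸ x) + upperDeficit n xs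

lowerExcess : ℕ → List ℕ → ℕ
lowerExcess t []       = 0
lowerExcess t (y ∷ ys) = suc (2 * t) * y + lowerExcess (suc t) ys

gsum-upper : ∀ h n i A → i + length A ≡ h → All (_≤ n) A →
  gsum (h + h) (suc i) A ℤ.+ + upperDeficit n A ≡ + (length A * length A * n)
gsum-upper h n i []      _    _            = refl
gsum-upper _ n i (x ∷ A) refl (x≤n ∷ A≤n) = begin
  (c ℤ.* + x ℤ.+ G) ℤ.+ + (a * (n ∸ x) + U)                  ≡⟨ cong₂ (λ cx d → (cx ℤ.+ G) ℤ.+ d) weighted-x (ℤP.pos-+ (a * (n ∸ x)) U) ⟩
  (+ (a * x) ℤ.+ G) ℤ.+ (+ (a * (n ∸ x)) ℤ.+ + U)            ≡⟨ regroup (+ (a * x)) G (+ (a * (n ∸ x))) (+ U) ⟩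
  (+ (a * x) ℤ.+ + (a * (n ∸ x))) ℤ.+ (G ℤ.+ + U)            ≡⟨ cong₂ ℤ._+_ (sym (ℤP.pos-+ (a * x) (a * (n ∸ x)))) IH ⟩
  + (a * x + a * (n ∸ x)) ℤ.+ + (m * m * n)                  ≡⟨ ℤP.pos-+ (a * x + a * (n ∸ x)) (m * m * n) ⟨
  + (a * x + a * (n ∸ x) + m * m * n)                        ≡⟨ cong (λ z → + (z + m * m * n)) ax+a[n∸x]≡an ⟩
  + (a * n + m * m * n)                                      ≡⟨ cong +_ (odd-step m n) ⟩
  + (suc m * suc m * n)                                      ∎
  where
  open ≡-Reasoning
  m = length A
  a = suc (2 * m)
  U = upperDeficit n A
  c = + (i + suc m + (i + suc m) + 1) ℤ.- + (2 * suc i)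
  G = gsum (i + suc m + (i + suc m)) (suc (suc i)) A
  position : ∀ i m → i + suc m + (i + suc m) + 1 ≡ 2 * suc i + suc (2 * m)
  position = ℕ-Solver.solve-∀
  ax+a[n∸x]≡an : a * x + a * (n ∸ x) ≡ a * n
  ax+a[n∸x]≡an = trans (sym (*-distribˡ-+ a x (n ∸ x))) (cong (a *_) (m+[n∸m]≡n x≤n))
  weighted-x : c ℤ.* + x ≡ + (a * x)
  weighted-x = trans (cong (ℤ._* + x) (pos-minus-pos _ (2 * suc i) a (position i m))) (sym (ℤP.pos-* a x))
  regroup : ∀ X G Y U → (X ℤ.+ G) ℤ.+ (Y ℤ.+ U) ≡ (X ℤ.+ Y) ℤ.+ (G ℤ.+ U)
  regroup = solve-∀
  odd-step : ∀ m n → suc (2 * m) * n + m * m * n ≡ suc m * suc m * n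
  odd-step = ℕ-Solver.solve-∀
  IH : G ℤ.+ + U ≡ + (m * m * n)
  IH = gsum-upper (i + suc m) n (suc i) A (sym (+-suc i m)) A≤n

gsum-lower : ∀ h t B → gsum (h + h) (suc (h + t)) B ℤ.+ + lowerExcess t B ≡ + 0
gsum-lower h t []      = refl
gsum-lower h t (y ∷ B) = begin
  (c ℤ.* + y ℤ.+ G) ℤ.+ + (a * y + E)              ≡⟨ cong₂ (λ c d → (c ℤ.* + y ℤ.+ G) ℤ.+ d) coefficient (pos-+-* a y E) ⟩
  (- + a ℤ.* + y ℤ.+ G) ℤ.+ (+ a ℤ.* + y ℤ.+ + E)  ≡⟨ cancel (+ a) (+ y) G (+ E) ⟩
  G ℤ.+ + E                                        ≡⟨ cong (λ j → gsum (h + h) (suc j) B ℤ.+ + E) (+-suc h t) ⟨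
  gsum (h + h) (suc (h + suc t)) B ℤ.+ + E         ≡⟨ gsum-lower h (suc t) B ⟩
  + 0                                              ∎
  where
  open ≡-Reasoning
  a = suc (2 * t)
  E = lowerExcess (suc t) B
  c = + (h + h + 1) ℤ.- + (2 * suc (h + t))
  G = gsum (h + h) (suc (suc (h + t))) B
  position : ∀ h t → 2 * suc (h + t) ≡ h + h + 1 + suc (2 * t)
  position = ℕ-Solver.solve-∀
  coefficient : c ≡ - + a
  coefficient = pos-minus-pos′ (h + h + 1) _ a (position h t)
  cancel : ∀ A Y G E → (- A ℤ.* Y ℤ.+ G) ℤ.+ (A ℤ.* Y ℤ.+ E) ≡ G ℤ.+ E
  cancel = solve-∀

g-halves : ∀ h n A B → length A ≡ h → All (_≤ n) A →
  g (h + h) (A ++ B) ℤ.+ + (upperDeficit n A + lowerExcess 0 B) ≡ + (h * h * n)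
g-halves _ n A B refl A≤n = begin
  gsum k 1 (A ++ B) ℤ.+ + (upperDeficit n A + lowerExcess 0 B)
    ≡⟨ cong₂ ℤ._+_ (gsum-++ k 1 A B) (ℤP.pos-+ (upperDeficit n A) (lowerExcess 0 B)) ⟩
  (gsum k 1 A ℤ.+ gsum k (suc h) B) ℤ.+ (+ upperDeficit n A ℤ.+ + lowerExcess 0 B)
    ≡⟨ regroup (gsum k 1 A) (gsum k (suc h) B) (+ upperDeficit n A) (+ lowerExcess 0 B) ⟩
  (gsum k 1 A ℤ.+ + upperDeficit n A) ℤ.+ (gsum k (suc h) B ℤ.+ + lowerExcess 0 B)
    ≡⟨ cong₂ ℤ._+_ (gsum-upper h n 0 A refl A≤n) lower-half ⟩
  + (h * h * n) ℤ.+ + 0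
    ≡⟨ ℤP.+-identityʳ (+ (h * h * n)) ⟩
  + (h * h * n) ∎
  where
  open ≡-Reasoning
  h = length A
  k = h + h
  regroup : ∀ X Y U V → (X ℤ.+ Y) ℤ.+ (U ℤ.+ V) ≡ (X ℤ.+ U) ℤ.+ (Y ℤ.+ V)
  regroup = solve-∀
  lower-half : gsum k (suc h) B ℤ.+ + lowerExcess 0 B ≡ + 0
  lower-half = trans (cong (λ j → gsum k (suc j) B ℤ.+ + lowerExcess 0 B) (sym (+-identityʳ h))) (gsum-lower h 0 B)

upperDeficit≡0 : ∀ n A → All (_≤ n) A → upperDeficit n A ≡ 0 → All (_≡ n) A
upperDeficit≡0 n []      _            _  = []
upperDeficit≡0 n (x ∷ A) (x≤n ∷ A≤n) eq =
  ≤-antisym x≤n (m∸n≡0⇒m≤n (m+n≡0⇒m≡0 (n ∸ x) (m+n≡0⇒m≡0 _ eq))) ∷ upperDeficit≡0 n A A≤n (m+n≡0⇒n≡0 _ eq)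

lowerExcess≡0 : ∀ t B → lowerExcess t B ≡ 0 → All (_≡ 0) B
lowerExcess≡0 t []      _  = []
lowerExcess≡0 t (y ∷ B) eq = m+n≡0⇒m≡0 y (m+n≡0⇒m≡0 _ eq) ∷ lowerExcess≡0 (suc t) B (m+n≡0⇒n≡0 _ eq)

upperDeficit-full : ∀ n A → All (_≡ n) A → upperDeficit n A ≡ 0
upperDeficit-full n []      _            = refl
upperDeficit-full n (x ∷ A) (refl ∷ A≡n) =
  cong₂ _+_ (trans (cong (suc (2 * length A) *_) (n∸n≡0 x)) (*-zeroʳ (suc (2 * length A)))) (upperDeficit-full n A A≡n)

lowerExcess-empty : ∀ t B → All (_≡ 0) B → lowerExcess t B ≡ 0
lowerExcess-empty t []      _             = refl
lowerExcess-empty t (y ∷ B) (refl ∷ B≡0) = cong₂ _+_ (*-zeroʳ (suc (2 * t))) (lowerExcess-empty (suc t) B B≡0)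

module Halves (h : ℕ) where

  up down : Fin h → Fin (h + h)
  up   i = i ↑ˡ h
  down i = h ↑ʳ i

  upThenDown : List (Fin h) → List (Fin h) → List (Fin (h + h))
  upThenDown u v = map up u ++ map down v

  isUp-up : ∀ i → isUp (up i) ≡ true
  isUp-up i = ⌊⌋-true (suc (toℕ (up i)) ≤? ⌊ h + h /2⌋)
    (subst₂ (λ a b → suc a ≤ b) (sym (toℕ-↑ˡ i h)) (n≡⌊n+n/2⌋ h) (toℕ<n i))

  isUp-down : ∀ i → isUp (down i) ≡ false
  isUp-down i = ⌊⌋-false (suc (toℕ (down i)) ≤? ⌊ h + h /2⌋)
    (λ le → <-irrefl refl (≤-trans (subst₂ (λ a b → suc a ≤ b) (toℕ-↑ʳ h i) (sym (n≡⌊n+n/2⌋ h)) le) (m≤m+n h (toℕ i))))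

  isDown-up : ∀ i → isDown (up i) ≡ false
  isDown-up i = ⌊⌋-false (suc ⌈ h + h /2⌉ ≤? suc (toℕ (up i)))
    (λ le → <⇒≱ (toℕ<n i) (subst₂ _≤_ (sym (n≡⌈n+n/2⌉ h)) (toℕ-↑ˡ i h) (≤-pred le)))

  isDown-down : ∀ i → isDown (down i) ≡ true
  isDown-down i = ⌊⌋-true (suc ⌈ h + h /2⌉ ≤? suc (toℕ (down i)))
    (s≤s (subst₂ _≤_ (n≡⌈n+n/2⌉ h) (sym (toℕ-↑ʳ h i)) (m≤m+n h (toℕ i))))

  occ-up-map-up : ∀ i xs → occ (up i) (map up xs) ≡ occ i xs
  occ-up-map-up = occ-map-injective up (↑ˡ-injective h _ _)

  occ-down-map-down : ∀ i xs → occ (down i) (map down xs) ≡ occ i xs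
  occ-down-map-down = occ-map-injective down (↑ʳ-injective h _ _)

  occ-up-map-down : ∀ i xs → occ (up i) (map down xs) ≡ 0
  occ-up-map-down i = occ-map-∉ down (up i) (λ a eq → ↑ˡ≢↑ʳ i a (sym eq))

  occ-down-map-up : ∀ i xs → occ (down i) (map up xs) ≡ 0
  occ-down-map-up i = occ-map-∉ up (down i) (λ a eq → ↑ˡ≢↑ʳ a i eq)

  occ-up-upThenDown : ∀ i u v → occ (up i) (upThenDown u v) ≡ occ i u
  occ-up-upThenDown i u v = trans (occ-++ (up i) (map up u) (map down v))
    (trans (cong₂ _+_ (occ-up-map-up i u) (occ-up-map-down i v)) (+-identityʳ (occ i u)))

  occ-down-upThenDown : ∀ i u v → occ (down i) (upThenDown u v) ≡ occ i v
  occ-down-upThenDown i u v = trans (occ-++ (down i) (map up u) (map down v))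
    (cong₂ _+_ (occ-down-map-up i u) (occ-down-map-down i v))

  point-halves : ∀ w → point w ≡ tabulate (λ i → occ (up i) w) ++ tabulate (λ i → occ (down i) w)
  point-halves w = trans (point-tabulate w) (tabulate-+ h h (λ a → occ a w))

  point-upThenDown : ∀ u v → point (upThenDown u v) ≡ point u ++ point v
  point-upThenDown u v = begin
    point (upThenDown u v)
      ≡⟨ point-halves (upThenDown u v) ⟩
    tabulate (λ i → occ (up i) (upThenDown u v)) ++ tabulate (λ i → occ (down i) (upThenDown u v))
      ≡⟨ cong₂ _++_ (tabulate-cong (λ i → occ-up-upThenDown i u v)) (tabulate-cong (λ i → occ-down-upThenDown i u v)) ⟩
    tabulate (λ i → occ i u) ++ tabulate (λ i → occ i v)
      ≡⟨ cong₂ _++_ (point-tabulate u) (point-tabulate v) ⟨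
    point u ++ point v ∎
    where open ≡-Reasoning

  weaklyDecreasing-map-up : ∀ p → weaklyDecreasing (point (map up p)) ≡ weaklyDecreasing (point p)
  weaklyDecreasing-map-up p = begin
    weaklyDecreasing (point (map up p))               ≡⟨ cong (weaklyDecreasing ∘ point) (sym (++-identityʳ (map up p))) ⟩
    weaklyDecreasing (point (upThenDown p []))        ≡⟨ cong weaklyDecreasing (point-upThenDown p []) ⟩
    weaklyDecreasing (point p ++ point {h} [])        ≡⟨ cong (λ zs → weaklyDecreasing (point p ++ zs)) (point-const 0 [] (λ _ → refl)) ⟩
    weaklyDecreasing (point p ++ replicate h 0)       ≡⟨ weaklyDecreasing-++-zeros (point p) h ⟩
    weaklyDecreasing (point p)                        ∎
    where open ≡-Reasoning

  weaklyDecreasing-upThenDown : ∀ n u q r → (∀ i → occ i u ≡ n) → (∀ i → occ i (q ++ r) ≡ n) →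
    weaklyDecreasing (point (upThenDown u q)) ≡ weaklyDecreasing (point q)
  weaklyDecreasing-upThenDown n u q r u-balanced qr-balanced = begin
    weaklyDecreasing (point (upThenDown u q))         ≡⟨ cong weaklyDecreasing (point-upThenDown u q) ⟩
    weaklyDecreasing (point u ++ point q)             ≡⟨ cong (λ zs → weaklyDecreasing (zs ++ point q)) (point-const n u u-balanced) ⟩
    weaklyDecreasing (replicate h n ++ point q)       ≡⟨ weaklyDecreasing-replicate-++ h n (point q) (point-prefix-≤ n q r qr-balanced) ⟩
    weaklyDecreasing (point q)                        ∎
    where open ≡-Reasoning

  prefix-upThenDown : ∀ u v p r → upThenDown u v ≡ p ++ r →
    (∃₂ λ p′ r′ → p ≡ map up p′ × u ≡ p′ ++ r′) ⊎ (∃₂ λ q r′ → p ≡ upThenDown u q × v ≡ q ++ r′)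
  prefix-upThenDown u v p r eq with prefix-++ (map up u) (map down v) p r eq
  ... | inj₁ (r′ , u≡) = inj₁ (prefix-map up u p r′ u≡)
  ... | inj₂ (q , refl , v≡) with prefix-map down v q r v≡
  ...   | q′ , r′ , refl , v≡′ = inj₂ (q′ , r′ , refl , v≡′)

  ballot-upThenDown⁻ : ∀ n u v → Ballot (h + h) n (upThenDown u v) → Ballot h n u × Ballot h n v
  ballot-upThenDown⁻ n u v b = ballot-u , ballot-v
    where
    ballot-u : Ballot h n u
    ballot-u .balanced i = trans (sym (occ-up-upThenDown i u v)) (balanced b (up i))
    ballot-u .prefixes p r refl = trans (sym (weaklyDecreasing-map-up p))
      (prefixes b (map up p) (map up r ++ map down v) (trans (cong (_++ map down v) (map-++ up p r)) (++-assoc (map up p) _ _)))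
    ballot-v : Ballot h n v
    ballot-v .balanced i = trans (sym (occ-down-upThenDown i u v)) (balanced b (down i))
    ballot-v .prefixes q r refl = trans (sym (weaklyDecreasing-upThenDown n u q r (balanced ballot-u) (balanced ballot-v)))
      (prefixes b (upThenDown u q) (map down r) (trans (cong (map up u ++_) (map-++ down q r)) (sym (++-assoc (map up u) _ _))))

  ballot-upThenDown⁺ : ∀ n u v → Ballot h n u → Ballot h n v → Ballot (h + h) n (upThenDown u v)
  ballot-upThenDown⁺ n u v bu bv .balanced a with side h a
  ... | left  i = trans (occ-up-upThenDown i u v) (balanced bu i)
  ... | right i = trans (occ-down-upThenDown i u v) (balanced bv i)
  ballot-upThenDown⁺ n u v bu bv .prefixes p r eq with prefix-upThenDown u v p r eq
  ... | inj₁ (p′ , r′ , refl , u≡) = trans (weaklyDecreasing-map-up p′) (prefixes bu p′ r′ u≡)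
  ... | inj₂ (q , r′ , refl , refl) = trans (weaklyDecreasing-upThenDown n u q r′ (balanced bu) (balanced bv)) (prefixes bv q r′ refl)

  isBallot-upThenDown : ∀ n u v → isBallot (h + h) n (upThenDown u v) ≡ isBallot h n u ∧ isBallot h n v
  isBallot-upThenDown n u v = bool-ext
    (λ e → let bu , bv = ballot-upThenDown⁻ n u v (isBallot⁻ (h + h) n _ e) in
           cong₂ _∧_ (isBallot⁺ h n u bu) (isBallot⁺ h n v bv))
    (λ e → let u? , v? = ∧-true {isBallot h n u} e in
           isBallot⁺ (h + h) n _ (ballot-upThenDown⁺ n u v (isBallot⁻ h n u u?) (isBallot⁻ h n v v?)))

  all-isUp-map-up : ∀ x → all isUp (map up x) ≡ true
  all-isUp-map-up x = trans (cong and (sym (map-∘ x))) (all-true⁺ (isUp ∘ up) x isUp-up)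

  all-isDown-map-down : ∀ y → all isDown (map down y) ≡ true
  all-isDown-map-down y = trans (cong and (sym (map-∘ y))) (all-true⁺ (isDown ∘ down) y isDown-down)

  -- Split words of length a + b as u ++ v: R vanishes unless u consists of up-steps
  -- and v of down-steps, so both sums restrict to words over Fin h.
  count-upThenDown : ∀ a b (R : List (Fin (h + h)) → Bool) (P Q : List (Fin h) → Bool) →
    (∀ w → R w ≡ true → ∃₂ λ x y → w ≡ upThenDown x y × length x ≡ a) →
    (∀ u v → length u ≡ a → length v ≡ b → R (upThenDown u v) ≡ P u ∧ Q v) →
    length (filterᵇ R (words (h + h) (a + b))) ≡ length (filterᵇ P (words h a)) * length (filterᵇ Q (words h b))
  count-upThenDown a b R P Q R⇒upThenDown R-upThenDown = begin
    length (filterᵇ R (words (h + h) (a + b)))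
      ≡⟨ length-filterᵇ R (words (h + h) (a + b)) ⟩
    ∑words (h + h) (a + b) F
      ≡⟨ ∑words-+ (h + h) a b F ⟩
    ∑words (h + h) b (λ v → ∑words (h + h) a (λ u → F (u ++ v)))
      ≡⟨ ∑words-cong (h + h) b (λ v _ → restrict-first-half v) ⟩
    ∑words (h + h) b (λ v → ∑words h a (λ u → F (map up u ++ v)))
      ≡⟨ restrict-second-half ⟩
    ∑words h b (λ v → ∑words h a (λ u → F (upThenDown u v)))
      ≡⟨ ∑words-cong h b (λ v ∣v∣ → ∑words-cong h a (λ u ∣u∣ → trans (cong 𝟙 (R-upThenDown u v ∣u∣ ∣v∣)) (𝟙-∧ (P u) (Q v)))) ⟩
    ∑words h b (λ v → ∑words h a (λ u → 𝟙 (P u) * 𝟙 (Q v)))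
      ≡⟨ ∑-cong (words h b) (λ v → ∑-*ʳ (words h a) (𝟙 ∘ P) (𝟙 (Q v))) ⟩
    ∑words h b (λ v → ∑words h a (𝟙 ∘ P) * 𝟙 (Q v))
      ≡⟨ ∑-*ˡ (words h b) (∑words h a (𝟙 ∘ P)) (𝟙 ∘ Q) ⟩
    ∑words h a (𝟙 ∘ P) * ∑words h b (𝟙 ∘ Q)
      ≡⟨ cong₂ _*_ (length-filterᵇ P (words h a)) (length-filterᵇ Q (words h b)) ⟨
    length (filterᵇ P (words h a)) * length (filterᵇ Q (words h b)) ∎
    where
    open ≡-Reasoning
    F : List (Fin (h + h)) → ℕ
    F = 𝟙 ∘ R
    up-part : ∀ v u → length u ≡ a → all isUp u ≡ false → F (u ++ v) ≡ 0
    up-part v u ∣u∣ not-up = 𝟙-false λ Ruv →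
      let x , y , u++v≡ , ∣x∣ = R⇒upThenDown (u ++ v) Ruv
          u≡ , _ = ++-injective u v (map up x) (map down y) u++v≡ (trans ∣u∣ (sym (trans (length-map up x) ∣x∣)))
      in contradiction (trans (sym not-up) (trans (cong (all isUp) u≡) (all-isUp-map-up x))) λ ()
    down-part : ∀ v → length v ≡ b → all isDown v ≡ false → ∑words h a (λ u → F (map up u ++ v)) ≡ 0
    down-part v ∣v∣ not-down = trans (∑words-cong h a (λ u ∣u∣ → 𝟙-false λ Ruv →
      let x , y , u++v≡ , ∣x∣ = R⇒upThenDown (map up u ++ v) Ruv
          _ , v≡ = ++-injective (map up u) v (map up x) (map down y) u++v≡
                     (trans (length-map up u) (trans ∣u∣ (sym (trans (length-map up x) ∣x∣))))
      in contradiction (trans (sym not-down) (trans (cong (all isDown) v≡) (all-isDown-map-down y))) λ ()))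
      (∑-zero (words h a))
    restrict-first-half : ∀ v → ∑words (h + h) a (λ u → F (u ++ v)) ≡ ∑words h a (λ u → F (map up u ++ v))
    restrict-first-half v = ∑words-restrict up down isUp (∑-allFin-+ h h) isUp-down a _ (up-part v)
    restrict-second-half : ∑words (h + h) b (λ v → ∑words h a (λ u → F (map up u ++ v)))
                         ≡ ∑words h b (λ v → ∑words h a (λ u → F (upThenDown u v)))
    restrict-second-half = ∑words-restrict down up isDown
      (λ G → trans (∑-allFin-+ h h G) (+-comm (∑ (allFin h) (G ∘ up)) _)) isDown-up b _ down-part

  count-ballots-upThenDown : ∀ n (S : List (Fin (h + h)) → Bool) →
    (∀ w → Ballot (h + h) n w → S w ≡ true → ∃₂ λ x y → w ≡ upThenDown x y) →
    (∀ u v → length u ≡ h * n → length v ≡ h * n → Ballot h n u → Ballot h n v → S (upThenDown u v) ≡ true) →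
    length (filterᵇ (λ w → isBallot (h + h) n w ∧ S w) (words (h + h) ((h + h) * n))) ≡ C h n ^ 2
  count-ballots-upThenDown n S S⇒upThenDown S-upThenDown = begin
    length (filterᵇ R (words (h + h) ((h + h) * n)))    ≡⟨ cong (λ m → length (filterᵇ R (words (h + h) m))) (*-distribʳ-+ n h h) ⟩
    length (filterᵇ R (words (h + h) (h * n + h * n)))  ≡⟨ count-upThenDown (h * n) (h * n) R (isBallot h n) (isBallot h n) shape factor ⟩
    C h n * C h n                                        ≡⟨ cong (C h n *_) (*-identityʳ (C h n)) ⟨
    C h n ^ 2                                            ∎
    where
    open ≡-Reasoning
    R : List (Fin (h + h)) → Bool
    R w = isBallot (h + h) n w ∧ S w
    shape : ∀ w → R w ≡ true → ∃₂ λ x y → w ≡ upThenDown x y × length x ≡ h * n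
    shape w Rw with ∧-true {isBallot (h + h) n w} Rw
    ... | ballot , Sw with S⇒upThenDown w (isBallot⁻ (h + h) n w ballot) Sw
    ...   | x , y , refl = x , y , refl , length-balanced n x (balanced (proj₁ (ballot-upThenDown⁻ n x y (isBallot⁻ (h + h) n _ ballot))))
    factor : ∀ u v → length u ≡ h * n → length v ≡ h * n → R (upThenDown u v) ≡ isBallot h n u ∧ isBallot h n v
    factor u v ∣u∣ ∣v∣ = trans (cong (_∧ S (upThenDown u v)) (isBallot-upThenDown n u v)) (∧-implied λ uv →
      let bu , bv = ∧-true {isBallot h n u} uv in S-upThenDown u v ∣u∣ ∣v∣ (isBallot⁻ h n u bu) (isBallot⁻ h n v bv))

  peakAt-up-down : ∀ c d → peakAt (up c) (down d) ≡ 1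
  peakAt-up-down c d = trans (peakAt≡𝟙 (up c) (down d)) (cong 𝟙 (cong₂ _∧_ (isUp-up c) (isDown-down d)))

  peakAt-up-up : ∀ c d → peakAt (up c) (up d) ≡ 0
  peakAt-up-up c d = trans (peakAt≡𝟙 (up c) (up d)) (cong 𝟙 (cong₂ _∧_ (isUp-up c) (isDown-up d)))

  peakAt-down : ∀ c b → peakAt (down c) b ≡ 0
  peakAt-down c b = trans (peakAt≡𝟙 (down c) b) (cong (λ x → 𝟙 (x ∧ isDown b)) (isUp-down c))

  peaks-map-down : ∀ ys → peaks (map down ys) ≡ 0
  peaks-map-down []           = refl
  peaks-map-down (y ∷ [])     = refl
  peaks-map-down (y ∷ z ∷ ys) = cong₂ _+_ (peakAt-down y (down z)) (peaks-map-down (z ∷ ys))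

  peaks-upThenDown : ∀ x xs y ys → peaks (upThenDown (x ∷ xs) (y ∷ ys)) ≡ 1
  peaks-upThenDown x []       y ys = cong₂ _+_ (peakAt-up-down x y) (peaks-map-down (y ∷ ys))
  peaks-upThenDown x (z ∷ xs) y ys = cong₂ _+_ (peakAt-up-up x z) (peaks-upThenDown z xs y ys)

  upThenDown⊎valley : ∀ w → (∃₂ λ x y → w ≡ upThenDown x y) ⊎ (∃₂ λ p d → ∃₂ λ e q → w ≡ p ++ down d ∷ up e ∷ q)
  upThenDown⊎valley []      = inj₁ ([] , [] , refl)
  upThenDown⊎valley (a ∷ w) with side h a | upThenDown⊎valley w
  ... | left  i | inj₁ (x , y , refl)     = inj₁ (i ∷ x , y , refl)
  ... | right d | inj₁ ([] , y , refl)    = inj₁ ([] , d ∷ y , refl)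
  ... | right d | inj₁ (e ∷ x , y , refl) = inj₂ ([] , d , e , upThenDown x y , refl)
  ... | _       | inj₂ (p , d , e , q , refl) = inj₂ (a ∷ p , d , e , q , refl)

  peak-between-up-down : ∀ c r d → 1 ≤ peaks (up c ∷ r ++ [ down d ])
  peak-between-up-down c []      d = ≤-reflexive (sym (cong (_+ 0) (peakAt-up-down c d)))
  peak-between-up-down c (a ∷ r) d with side h a
  ... | left  c′ = ≤-trans (peak-between-up-down c′ r d) (m≤n+m _ (peakAt (up c) (up c′)))
  ... | right d′ = ≤-trans (≤-reflexive (sym (peakAt-up-down c d′))) (m≤m+n (peakAt (up c) (down d′)) _)

  ups⊎peak : ∀ e q → (∃ λ z → q ≡ map up z) ⊎ 1 ≤ peaks (up e ∷ q)
  ups⊎peak e []      = inj₁ ([] , refl)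
  ups⊎peak e (a ∷ q) with side h a
  ... | right d = inj₂ (≤-trans (≤-reflexive (sym (peakAt-up-down e d))) (m≤m+n (peakAt (up e) (down d)) _))
  ... | left  c with ups⊎peak c q
  ...   | inj₁ (z , refl) = inj₁ (c ∷ z , refl)
  ...   | inj₂ 1≤peaks    = inj₂ (≤-trans 1≤peaks (m≤n+m _ (peakAt (up e) (up c))))

  ups⊎two-peaks : ∀ c p d e q → (∃ λ z → q ≡ map up z) ⊎ 2 ≤ peaks (up c ∷ p ++ down d ∷ up e ∷ q)
  ups⊎two-peaks c p d e q with ups⊎peak e q
  ... | inj₁ ups        = inj₁ ups
  ... | inj₂ 1≤peaks    = inj₂ (begin
    2                                                    ≤⟨ +-mono-≤ (peak-between-up-down c p d) 1≤peaks ⟩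
    peaks (up c ∷ p ++ [ down d ]) + peaks (up e ∷ q)    ≤⟨ peaks-++ (up c ∷ p ++ [ down d ]) (up e ∷ q) ⟩
    peaks ((up c ∷ p ++ [ down d ]) ++ up e ∷ q)         ≡⟨ cong (peaks ∘ (up c ∷_)) (++-assoc p [ down d ] (up e ∷ q)) ⟩
    peaks (up c ∷ p ++ down d ∷ up e ∷ q)                ∎)
    where open ≤-Reasoning

  down≤up : ∀ {n w} → Ballot (h + h) n w → Prefixwise (λ p → ∀ i → occ (down i) p ≤ occ (up i) p) w
  down≤up b p r eq i = tabulate⁻ (tabulate⁻ (weaklyDecreasing-++⁻ (tabulate (λ i → occ (up i) p)) _ wd) i) i
    where
    wd : weaklyDecreasing (tabulate (λ i → occ (up i) p) ++ tabulate (λ i → occ (down i) p)) ≡ true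
    wd = trans (cong weaklyDecreasing (sym (point-halves p))) (prefixes b p r eq)

  ballot-¬startsWithDown : ∀ {n w} → Ballot (h + h) n w → ∀ d rest → w ≢ down d ∷ rest
  ballot-¬startsWithDown b d rest eq =
    contradiction (subst₂ _≤_ (occ-∷-≡ (down d) []) (occ-up-map-down d [ d ]) (down≤up b [ down d ] rest eq d)) λ ()

  ballot-¬endsWithUp : ∀ {n w} → Ballot (h + h) n w → ∀ p e z → w ≢ p ++ map up (e ∷ z)
  ballot-¬endsWithUp {n} b p e z refl = <⇒≱ up<n n≤up
    where
    occ-down : occ (down e) p ≡ n
    occ-down = begin
      occ (down e) p                                    ≡⟨ +-identityʳ (occ (down e) p) ⟨
      occ (down e) p + 0                                ≡⟨ cong (_+_ (occ (down e) p)) (occ-down-map-up e (e ∷ z)) ⟨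
      occ (down e) p + occ (down e) (map up (e ∷ z))    ≡⟨ occ-++ (down e) p (map up (e ∷ z)) ⟨
      occ (down e) (p ++ map up (e ∷ z))                ≡⟨ balanced b (down e) ⟩
      n                                                 ∎
      where open ≡-Reasoning
    occ-up : occ (up e) p + suc (occ e z) ≡ n
    occ-up = begin
      occ (up e) p + suc (occ e z)                      ≡⟨ cong (_+_ (occ (up e) p)) (trans (occ-up-map-up e (e ∷ z)) (occ-∷-≡ e z)) ⟨
      occ (up e) p + occ (up e) (map up (e ∷ z))        ≡⟨ occ-++ (up e) p (map up (e ∷ z)) ⟨
      occ (up e) (p ++ map up (e ∷ z))                  ≡⟨ balanced b (up e) ⟩
      n                                                 ∎
      where open ≡-Reasoning
    up<n : occ (up e) p < n
    up<n = subst (occ (up e) p <_) occ-up (m<m+n (occ (up e) p) (s≤s z≤n))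
    n≤up : n ≤ occ (up e) p
    n≤up = subst (_≤ occ (up e) p) occ-down (down≤up b p _ refl e)

  onePeak⇒upThenDown : ∀ n w → Ballot (h + h) n w → peaks w ≡ 1 → ∃₂ λ x y → w ≡ upThenDown x y
  onePeak⇒upThenDown n w b one-peak with upThenDown⊎valley w
  ... | inj₁ upThenDown-shape = upThenDown-shape
  ... | inj₂ ([] , d , e , q , refl) = contradiction refl (ballot-¬startsWithDown b d _)
  ... | inj₂ (a ∷ p , d , e , q , refl) with side h a
  ...   | right c = contradiction refl (ballot-¬startsWithDown b c _)
  ...   | left  c with ups⊎two-peaks c p d e q
  ...     | inj₁ (z , refl) = contradiction (sym (++-assoc (up c ∷ p) [ down d ] _)) (ballot-¬endsWithUp b (up c ∷ p ++ [ down d ]) e z)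
  ...     | inj₂ 2≤peaks    = contradiction (subst (2 ≤_) one-peak 2≤peaks) λ { (s≤s ()) }

  N''-one-peak : ∀ n → 1 ≤ h * n → N'' (h + h) 1 n ≡ C h n ^ 2
  N''-one-peak n 1≤hn = count-ballots-upThenDown n (λ w → ⌊ peaks w ℕ.≟ 1 ⌋)
    (λ w b one-peak → onePeak⇒upThenDown n w b (⌊⌋-sound (peaks w ℕ.≟ 1) one-peak))
    one-peak
    where
    one-peak : ∀ u v → length u ≡ h * n → length v ≡ h * n → Ballot h n u → Ballot h n v →
      ⌊ peaks (upThenDown u v) ℕ.≟ 1 ⌋ ≡ true
    one-peak []      v       ∣u∣ ∣v∣ _ _ = contradiction (subst (1 ≤_) (sym ∣u∣) 1≤hn) λ ()
    one-peak (x ∷ u) []      ∣u∣ ∣v∣ _ _ = contradiction (subst (1 ≤_) (sym ∣v∣) 1≤hn) λ ()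
    one-peak (x ∷ u) (y ∷ v) ∣u∣ ∣v∣ _ _ = ⌊⌋-true (peaks (upThenDown (x ∷ u) (y ∷ v)) ℕ.≟ 1) (peaks-upThenDown x u y v)

  deficit : ℕ → List (Fin (h + h)) → ℕ
  deficit n p = upperDeficit n (tabulate (λ i → occ (up i) p)) + lowerExcess 0 (tabulate (λ i → occ (down i) p))

  g+deficit : ∀ n p → (∀ a → occ a p ≤ n) → g (h + h) (point p) ℤ.+ + deficit n p ≡ + (h ^ 2 * n)
  g+deficit n p p≤n = begin
    g (h + h) (point p) ℤ.+ + deficit n p  ≡⟨ cong (λ x → g (h + h) x ℤ.+ + deficit n p) (point-halves p) ⟩
    g (h + h) (ups ++ downs) ℤ.+ + deficit n p  ≡⟨ g-halves h n ups downs (length-tabulate _) (tabulate⁺ (p≤n ∘ up)) ⟩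
    + (h * h * n)                          ≡⟨ cong (λ z → + (h * z * n)) (*-identityʳ h) ⟨
    + (h ^ 2 * n)                          ∎
    where
    open ≡-Reasoning
    ups downs : List ℕ
    ups   = tabulate (λ i → occ (up i) p)
    downs = tabulate (λ i → occ (down i) p)

  deficit≡0⇒ups-full-downs-empty : ∀ n p → (∀ a → occ a p ≤ n) → deficit n p ≡ 0 →
    (∀ i → occ (up i) p ≡ n) × (∀ i → occ (down i) p ≡ 0)
  deficit≡0⇒ups-full-downs-empty n p p≤n D≡0 =
    tabulate⁻ (upperDeficit≡0 n _ (tabulate⁺ (p≤n ∘ up)) (m+n≡0⇒m≡0 _ D≡0)) ,
    tabulate⁻ (lowerExcess≡0 0 _ (m+n≡0⇒n≡0 _ D≡0))

  deficit-map-up : ∀ n u → (∀ i → occ i u ≡ n) → deficit n (map up u) ≡ 0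
  deficit-map-up n u u-balanced = cong₂ _+_
    (upperDeficit-full n _ (tabulate⁺ (λ i → trans (occ-up-map-up i u) (u-balanced i))))
    (lowerExcess-empty 0 _ (tabulate⁺ (λ i → occ-down-map-up i u)))

  no-down⇒map-up : ∀ p → (∀ i → occ (down i) p ≡ 0) → ∃ λ x → p ≡ map up x
  no-down⇒map-up []      no-down = [] , refl
  no-down⇒map-up (a ∷ p) no-down with side h a
  ... | right d = contradiction (trans (sym (occ-∷-≡ (down d) p)) (no-down d)) λ ()
  ... | left  c with no-down⇒map-up p (λ i → trans (sym (occ-∷-≢ p (↑ˡ≢↑ʳ c i))) (no-down i))
  ...   | x , refl = c ∷ x , refl

  no-up⇒map-down : ∀ p → (∀ i → occ (up i) p ≡ 0) → ∃ λ y → p ≡ map down y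
  no-up⇒map-down []      no-up = [] , refl
  no-up⇒map-down (a ∷ p) no-up with side h a
  ... | left  c = contradiction (trans (sym (occ-∷-≡ (up c) p)) (no-up c)) λ ()
  ... | right d with no-up⇒map-down p (λ i → trans (sym (occ-∷-≢ p (↑ˡ≢↑ʳ i d ∘ sym))) (no-up i))
  ...   | y , refl = d ∷ y , refl

  g≡max⇒deficit≡0 : ∀ n p → (∀ a → occ a p ≤ n) → g (h + h) (point p) ≡ + (h ^ 2 * n) → deficit n p ≡ 0
  g≡max⇒deficit≡0 n p p≤n g≡M = +-cancelˡ-≡ M (deficit n p) 0 (ℤP.+-injective (begin
    + (M + deficit n p)                      ≡⟨ ℤP.pos-+ M (deficit n p) ⟩
    + M ℤ.+ + deficit n p                    ≡⟨ cong (ℤ._+ + deficit n p) g≡M ⟨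
    g (h + h) (point p) ℤ.+ + deficit n p    ≡⟨ g+deficit n p p≤n ⟩
    + M                                      ≡⟨ cong +_ (+-identityʳ M) ⟨
    + (M + 0)                                ∎))
    where
    open ≡-Reasoning
    M = h ^ 2 * n

  max-prefix⇒upThenDown : ∀ n p r → Ballot (h + h) n (p ++ r) → g (h + h) (point p) ≡ + (h ^ 2 * n) →
    ∃₂ λ x y → p ++ r ≡ upThenDown x y
  max-prefix⇒upThenDown n p r b g≡M with no-down⇒map-up p (proj₂ ups-full-downs-empty) | no-up⇒map-down r r-no-up
    where
    p≤n = occ-prefix-≤ n p r (balanced b)
    ups-full-downs-empty = deficit≡0⇒ups-full-downs-empty n p p≤n (g≡max⇒deficit≡0 n p p≤n g≡M)
    r-no-up : ∀ i → occ (up i) r ≡ 0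
    r-no-up i = +-cancelˡ-≡ n (occ (up i) r) 0 (begin
      n + occ (up i) r                ≡⟨ cong (_+ occ (up i) r) (proj₁ ups-full-downs-empty i) ⟨
      occ (up i) p + occ (up i) r     ≡⟨ occ-++ (up i) p r ⟨
      occ (up i) (p ++ r)             ≡⟨ balanced b (up i) ⟩
      n                               ≡⟨ +-identityʳ n ⟨
      n + 0                           ∎)
      where open ≡-Reasoning
  ... | x , refl | y , refl = x , y , refl

  heightIs⇒upThenDown : ∀ n w → Ballot (h + h) n w → heightIs (h + h) (+ (h ^ 2 * n)) w ≡ true → ∃₂ λ x y → w ≡ upThenDown x y
  heightIs⇒upThenDown n w b height with any-inits⁻ _ w (proj₁ (∧-true height))
  ... | p , r , refl , g≟M = max-prefix⇒upThenDown n p r b (⌊⌋-sound (g (h + h) (point p) ℤ.≟ + (h ^ 2 * n)) g≟M)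

  heightIs-upThenDown : ∀ n u v → Ballot h n u → Ballot h n v → heightIs (h + h) (+ (h ^ 2 * n)) (upThenDown u v) ≡ true
  heightIs-upThenDown n u v bu bv = cong₂ _∧_
    (any-inits⁺ (λ p → ⌊ g (h + h) (point p) ℤ.≟ + M ⌋) (map up u) (map down v)
      (⌊⌋-true (g (h + h) (point (map up u)) ℤ.≟ + M) attained))
    (all-inits⁺ (λ p → ⌊ g (h + h) (point p) ℤ.≤? + M ⌋) w
      (λ p r eq → ⌊⌋-true (g (h + h) (point p) ℤ.≤? + M) (bounded p r eq)))
    where
    M = h ^ 2 * n
    w = upThenDown u v
    b = ballot-upThenDown⁺ n u v bu bv
    attained : g (h + h) (point (map up u)) ≡ + M
    attained = trans (sym (ℤP.+-identityʳ _))
      (trans (cong (λ d → g (h + h) (point (map up u)) ℤ.+ + d) (sym (deficit-map-up n u (balanced bu))))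
             (g+deficit n (map up u) (occ-prefix-≤ n (map up u) (map down v) (balanced b))))
    bounded : ∀ p r → w ≡ p ++ r → g (h + h) (point p) ℤ.≤ + M
    bounded p r eq = ℤP.≤-trans (ℤP.i≤i+j (g (h + h) (point p)) (+ deficit n p))
      (ℤP.≤-reflexive (g+deficit n p (occ-prefix-≤ n p r (λ a → trans (cong (occ a) (sym eq)) (balanced b a)))))

  D'-max-height : ∀ n → D' (h + h) (+ (h ^ 2 * n)) n ≡ C h n ^ 2
  D'-max-height n = count-ballots-upThenDown n (heightIs (h + h) (+ (h ^ 2 * n)))
    (heightIs⇒upThenDown n) (λ u v _ _ → heightIs-upThenDown n u v)

open Halves using (N''-one-peak; D'-max-height)

theorem6p5 : (k n : ℕ) → 2 ≤ k → 2 ∣ k → 1 ≤ n →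
    (N'' k 1 n ≡ C (k / 2) n ^ 2) × (C (k / 2) n ^ 2 ≡ D' k (+ ((k / 2) ^ 2 * n)) n)
theorem6p5 _ n 2≤k (divides h refl) 1≤n =
  subst₂ (λ k h → (N'' k 1 n ≡ C h n ^ 2) × (C h n ^ 2 ≡ D' k (+ (h ^ 2 * n)) n))
    (sym h*2≡h+h) (sym (m*n/n≡m h 2))
    (N''-one-peak h n 1≤h*n , sym (D'-max-height h n))
  where
  h*2≡h+h : h * 2 ≡ h + h
  h*2≡h+h = trans (*-suc h 1) (cong (_+_ h) (*-identityʳ h))
  1≤h*n : 1 ≤ h * n
  1≤h*n = *-mono-≤ (*-cancelʳ-≤ 1 h 2 2≤k) 1≤n
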